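{- For every integer $k\ge 1$ we have $f(k)\le k+4$. Moreover: (1) $f(k)=k+4$ if and only if $k=2^{2r}-1$ for some integer $r\ge 1$; (2) there is no $k\ge1$ with $f(k)=k+3$ or $f(k)=k+2$; (3) $f(k)=k+1$ if and only if $k=6$; (4) $f(k)=k$ if and only if $k=1$ or $k=2^r+1$ for some integer $r\ge 2$.
   Context: For a non-negative integer $n$, let $s_2(n)$ denote the sum of the binary digits of $n$, and let $t_n = s_2(n) \bmod 2$ (the Thue–Morse sequence). For $k\ge1$ let $\mathcal{N}_k=\{n\ge 0: t_{kn}=1\}$ and $f(k)=\min \mathcal{N}_k$ (this minimum exists for every $k \ge 1$). -}

module Defs where

open import Data.Nat using (ℕ; zero; suc; _+_; _*_; _<_; _%_; ⌊_/2⌋)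
open import Data.Product using (_×_)
open import Relation.Binary.PropositionalEquality using (_≡_)

-- binary digit sum with fuel; fuel ≥ n suffices since ⌊n/2⌋ < n for n > 0
s₂-go : ℕ → ℕ → ℕ
s₂-go zero    n = 0
s₂-go (suc f) n = n % 2 + s₂-go f ⌊ n /2⌋

s₂ : ℕ → ℕ
s₂ n = s₂-go n n

t : ℕ → ℕ
t n = s₂ n % 2

-- m is the minimum of 𝒩_k = { n : t (k n) = 1 }, i.e. m = f(k)
IsF : ℕ → ℕ → Set
IsF k m = (t (k * m) ≡ 1) × (∀ n → n < m → t (k * n) ≡ 0)

-- Since s₂(2x) = s₂(x), f(2k) = f(k) and it suffices to study odd k.  The odd k
-- equal to 1, 2^r + 1 or 4^r − 1 are handled by computing s₂(kn) for every n up to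
-- the claimed value of f(k).  Any other odd k has an n < k with s₂(kn) odd: read k
-- in binary as a block of U ones, a zero, a middle part M, a zero and a block of
-- L ones.  Multiplying by 2^c + 1 or 2^c − 1 adds or subtracts a shifted copy of k,
-- and when c sits at a block boundary no carries interact, so s₂(kn) is an explicit
-- linear expression in U, L, s₂(M) and the block positions.  Choosing n = 2^c ± 1
-- with c a suitable block boundary, according to the parities of L, of p + U (p the
-- position of the zero below the leading block) and of a 2-adic valuation, makes it odd.

module Submission where

open import Defs
open import Data.Nat using (ℕ; suc; _+_; _*_; _^_; _≤_; _≥_)
open import Data.Product using (Σ; _×_; ∃-syntax)
open import Data.Sum using (_⊎_)
open import Relation.Binary.PropositionalEquality using (_≡_)
open import Relation.Nullary using (¬_)
open import Function.Bundles using (_⇔_)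

open import Data.Nat
open import Data.Nat.DivMod using (m%n<n)
open import Data.Nat.Induction using (<-rec)
open import Data.Nat.Properties
open import Data.Nat.Tactic.RingSolver using (solve-∀)
open import Data.Parity.Base using (0ℙ; 1ℙ)
import Data.Parity.Base as ℙ
import Data.Parity.Properties as ℙ
open import Data.Product using (_,_)
open import Data.Sum using (inj₁; inj₂)
open import Data.Empty using (⊥-elim)
open import Function.Bundles using (mk⇔; Equivalence)
open import Relation.Binary.Definitions using (tri<; tri≈; tri>)
open import Relation.Binary.PropositionalEquality
open import Relation.Nullary using (yes; no)
open import Relation.Unary using (Decidable)

Odious Evil : ℕ → Set
Odious n = parity (s₂ n) ≡ 1ℙ
Evil n = parity (s₂ n) ≡ 0ℙ

parity≡1ℙ⇒%2≡1 : ∀ n → parity n ≡ 1ℙ → n % 2 ≡ 1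
parity≡1ℙ⇒%2≡1 1 _ = refl
parity≡1ℙ⇒%2≡1 (suc (suc n)) p = parity≡1ℙ⇒%2≡1 n p

parity≡0ℙ⇒%2≡0 : ∀ n → parity n ≡ 0ℙ → n % 2 ≡ 0
parity≡0ℙ⇒%2≡0 0 _ = refl
parity≡0ℙ⇒%2≡0 (suc (suc n)) p = parity≡0ℙ⇒%2≡0 n p

odious⇒t≡1 : ∀ n → Odious n → t n ≡ 1
odious⇒t≡1 n = parity≡1ℙ⇒%2≡1 (s₂ n)

evil⇒t≡0 : ∀ n → Evil n → t n ≡ 0
evil⇒t≡0 n = parity≡0ℙ⇒%2≡0 (s₂ n)

t≢1⇒t≡0 : ∀ n → t n ≢ 1 → t n ≡ 0
t≢1⇒t≡0 n t≢1 with t n | m%n<n (s₂ n) 2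
... | 0 | _ = refl
... | 1 | _ = ⊥-elim (t≢1 refl)
... | suc (suc _) | s≤s (s≤s ())

parity-double : ∀ q → parity (2 * q) ≡ 0ℙ
parity-double q = ℙ.*-homo-* 2 q

parity-double+1 : ∀ q → parity (1 + 2 * q) ≡ 1ℙ
parity-double+1 q = trans (ℙ.+-homo-+ 1 (2 * q)) (cong (1ℙ ℙ.+_) (parity-double q))

parity-double-+ : ∀ x y → parity (2 * x + y) ≡ parity y
parity-double-+ x y = trans (ℙ.+-homo-+ (2 * x) y) (cong (ℙ._+ parity y) (parity-double x))

parity-+-double : ∀ a b → parity (a + 2 * b) ≡ parity a
parity-+-double a b = trans (ℙ.+-homo-+ a (2 * b)) (trans (cong (parity a ℙ.+_) (parity-double b)) (ℙ.+-identityʳ (parity a)))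

parity-+-self : ∀ n → parity (n + n) ≡ 0ℙ
parity-+-self n = trans (ℙ.+-homo-+ n n) (ℙ.p+p≡0ℙ (parity n))

data EvenOdd : ℕ → Set where
  even : ∀ q → EvenOdd (2 * q)
  odd  : ∀ q → EvenOdd (1 + 2 * q)

evenOdd : ∀ n → EvenOdd n
evenOdd zero = even 0
evenOdd (suc n) with evenOdd n
... | even q = odd q
... | odd q = subst EvenOdd (double-suc q) (even (suc q))
  where
  double-suc : ∀ q → 2 * suc q ≡ 2 + 2 * q
  double-suc = solve-∀

binary-induction : (P : ℕ → Set) → P 0 → (∀ q → P q → P (2 * q)) → (∀ q → P q → P (1 + 2 * q)) →
                   ∀ n → P n
binary-induction P P0 P-even P-odd = <-rec P step
  where
  half<double : ∀ q → suc q < 2 * suc q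
  half<double q = m<m+n (suc q) z<s
  step : ∀ n → (∀ {m} → m < n → P m) → P n
  step n rec with evenOdd n
  ... | even zero = P0
  ... | even (suc q) = P-even (suc q) (rec (half<double q))
  ... | odd q = P-odd q (rec (s≤s (m≤m+n q (q + 0))))

odd≢even : ∀ m n → 1 + 2 * m ≢ 2 * n
odd≢even m n eq with () ← trans (sym (parity-double+1 m)) (trans (cong parity eq) (parity-double n))

halve : ∀ x y {n} → 2 * x + 2 * y ≡ 2 * n → x + y ≡ n
halve x y {n} e = *-cancelˡ-≡ (x + y) n 2 (trans (*-distribˡ-+ 2 x y) e)

s₂-go-empty : ∀ f → s₂-go f 0 ≡ 0
s₂-go-empty zero = refl
s₂-go-empty (suc f) = s₂-go-empty f

s₂-go-fuel : ∀ f g n → n ≤ f → n ≤ g → s₂-go f n ≡ s₂-go g n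
s₂-go-fuel zero zero n _ _ = refl
s₂-go-fuel zero (suc g) .0 z≤n _ = sym (s₂-go-empty (suc g))
s₂-go-fuel (suc f) zero .0 _ z≤n = s₂-go-empty (suc f)
s₂-go-fuel (suc f) (suc g) n n≤1+f n≤1+g =
  cong (n % 2 +_) (s₂-go-fuel f g ⌊ n /2⌋ (half≤ n≤1+f) (half≤ n≤1+g))
  where
  half≤ : ∀ {n f} → n ≤ suc f → ⌊ n /2⌋ ≤ f
  half≤ {zero} _ = z≤n
  half≤ {suc n} n≤f = ≤-pred (≤-trans (⌊n/2⌋<n n) n≤f)

s₂-unfold : ∀ n → s₂ n ≡ n % 2 + s₂ ⌊ n /2⌋
s₂-unfold zero = refl
s₂-unfold (suc n) = cong (suc n % 2 +_) (s₂-go-fuel n ⌊ suc n /2⌋ ⌊ suc n /2⌋ (≤-pred (⌊n/2⌋<n n)) ≤-refl)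

⌊2*q/2⌋≡q : ∀ q → ⌊ 2 * q /2⌋ ≡ q
⌊2*q/2⌋≡q zero = refl
⌊2*q/2⌋≡q (suc q) = trans (cong ⌊_/2⌋ (double-suc q)) (cong suc (⌊2*q/2⌋≡q q))
  where
  double-suc : ∀ q → 2 * suc q ≡ 2 + 2 * q
  double-suc = solve-∀

⌊1+2*q/2⌋≡q : ∀ q → ⌊ 1 + 2 * q /2⌋ ≡ q
⌊1+2*q/2⌋≡q zero = refl
⌊1+2*q/2⌋≡q (suc q) = trans (cong ⌊_/2⌋ (double-suc q)) (cong suc (⌊1+2*q/2⌋≡q q))
  where
  double-suc : ∀ q → 1 + 2 * suc q ≡ 3 + 2 * q
  double-suc = solve-∀

s₂-double : ∀ q → s₂ (2 * q) ≡ s₂ q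
s₂-double q = begin
  s₂ (2 * q)                     ≡⟨ s₂-unfold (2 * q) ⟩
  (2 * q) % 2 + s₂ ⌊ 2 * q /2⌋   ≡⟨ cong₂ _+_ (parity≡0ℙ⇒%2≡0 (2 * q) (parity-double q)) (cong s₂ (⌊2*q/2⌋≡q q)) ⟩
  s₂ q                           ∎
  where open ≡-Reasoning

s₂-double+1 : ∀ q → s₂ (1 + 2 * q) ≡ 1 + s₂ q
s₂-double+1 q = begin
  s₂ (1 + 2 * q)                         ≡⟨ s₂-unfold (1 + 2 * q) ⟩
  (1 + 2 * q) % 2 + s₂ ⌊ 1 + 2 * q /2⌋   ≡⟨ cong₂ _+_ (parity≡1ℙ⇒%2≡1 (1 + 2 * q) (parity-double+1 q)) (cong s₂ (⌊1+2*q/2⌋≡q q)) ⟩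
  1 + s₂ q                               ∎
  where open ≡-Reasoning

2^<2^suc : ∀ n → 2 ^ n < 2 ^ suc n
2^<2^suc n = ^-monoʳ-< 2 (s≤s (s≤s z≤n)) (n<1+n n)

2^-reflects-≤ : ∀ {a b} → 2 ^ a ≤ 2 ^ b → a ≤ b
2^-reflects-≤ 2^a≤2^b = ≮⇒≥ (λ b<a → <⇒≱ (^-monoʳ-< 2 (s≤s (s≤s z≤n)) b<a) 2^a≤2^b)

ones : ℕ → ℕ
ones zero = 0
ones (suc a) = 1 + 2 * ones a

suc-ones : ∀ a → suc (ones a) ≡ 2 ^ a
suc-ones zero = refl
suc-ones (suc a) = trans (double-suc (ones a)) (cong (2 *_) (suc-ones a))
  where
  double-suc : ∀ n → 2 + 2 * n ≡ 2 * suc n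
  double-suc = solve-∀

ones<2^ : ∀ a → ones a < 2 ^ a
ones<2^ a = ≤-reflexive (suc-ones a)

ones<2^suc : ∀ a → ones a < 2 ^ suc a
ones<2^suc a = <-trans (ones<2^ a) (2^<2^suc a)

ones<2^*suc : ∀ c h l → ones c < 2 ^ c * suc h + l
ones<2^*suc c h l = <-≤-trans (ones<2^ c) (≤-trans (m≤m*n (2 ^ c) (suc h)) (m≤m+n (2 ^ c * suc h) l))

ones-+ : ∀ a b → ones (a + b) ≡ 2 ^ b * ones a + ones b
ones-+ a b = suc-injective (begin
  suc (ones (a + b))             ≡⟨ suc-ones (a + b) ⟩
  2 ^ (a + b)                    ≡⟨ ^-distribˡ-+-* 2 a b ⟩
  2 ^ a * 2 ^ b                  ≡⟨ cong₂ _*_ (suc-ones a) (suc-ones b) ⟨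
  suc (ones a) * suc (ones b)    ≡⟨ expand (ones a) (ones b) ⟩
  suc (suc (ones b) * ones a + ones b) ≡⟨ cong (λ x → suc (x * ones a + ones b)) (suc-ones b) ⟩
  suc (2 ^ b * ones a + ones b)  ∎)
  where
  open ≡-Reasoning
  expand : ∀ x y → suc x * suc y ≡ suc (suc y * x + y)
  expand = solve-∀

s₂-ones : ∀ a → s₂ (ones a) ≡ a
s₂-ones zero = refl
s₂-ones (suc a) = trans (s₂-double+1 (ones a)) (cong suc (s₂-ones a))

s₂-1+4*ones : ∀ a → s₂ (1 + 2 * (2 * ones a)) ≡ suc a
s₂-1+4*ones a = trans (s₂-double+1 (2 * ones a)) (cong suc (trans (s₂-double (ones a)) (s₂-ones a)))

s₂-concat : ∀ a m b → b < 2 ^ a → s₂ (2 ^ a * m + b) ≡ s₂ m + s₂ b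
s₂-concat zero m zero _ =
  trans (cong s₂ (trans (+-identityʳ (1 * m)) (*-identityˡ m))) (sym (+-identityʳ (s₂ m)))
s₂-concat zero m (suc b) (s≤s ())
s₂-concat (suc a) m b b<2^a with evenOdd b
... | even q = begin
  s₂ (2 ^ suc a * m + 2 * q)    ≡⟨ cong s₂ (shift (2 ^ a) m q) ⟩
  s₂ (2 * (2 ^ a * m + q))      ≡⟨ s₂-double (2 ^ a * m + q) ⟩
  s₂ (2 ^ a * m + q)            ≡⟨ s₂-concat a m q (*-cancelˡ-< 2 q (2 ^ a) b<2^a) ⟩
  s₂ m + s₂ q                   ≡⟨ cong (s₂ m +_) (s₂-double q) ⟨
  s₂ m + s₂ (2 * q)             ∎
  where
  open ≡-Reasoning
  shift : ∀ x m q → 2 * x * m + 2 * q ≡ 2 * (x * m + q)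
  shift = solve-∀
... | odd q = begin
  s₂ (2 ^ suc a * m + (1 + 2 * q))  ≡⟨ cong s₂ (shift (2 ^ a) m q) ⟩
  s₂ (1 + 2 * (2 ^ a * m + q))      ≡⟨ s₂-double+1 (2 ^ a * m + q) ⟩
  1 + s₂ (2 ^ a * m + q)            ≡⟨ cong suc (s₂-concat a m q (*-cancelˡ-< 2 q (2 ^ a) (<-trans (n<1+n (2 * q)) b<2^a))) ⟩
  1 + (s₂ m + s₂ q)                 ≡⟨ +-suc (s₂ m) (s₂ q) ⟨
  s₂ m + (1 + s₂ q)                 ≡⟨ cong (s₂ m +_) (s₂-double+1 q) ⟨
  s₂ m + s₂ (1 + 2 * q)             ∎
  where
  open ≡-Reasoning
  shift : ∀ x m q → 2 * x * m + (1 + 2 * q) ≡ 1 + 2 * (x * m + q)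
  shift = solve-∀

s₂-2^ : ∀ a → s₂ (2 ^ a) ≡ 1
s₂-2^ a = trans (cong s₂ (sym (trans (+-identityʳ _) (*-identityʳ (2 ^ a))))) (s₂-concat a 1 0 (m^n>0 2 a))

s₂-2^* : ∀ z m → s₂ (2 ^ z * m) ≡ s₂ m
s₂-2^* z m = trans (cong s₂ (sym (+-identityʳ (2 ^ z * m)))) (trans (s₂-concat z m 0 (m^n>0 2 z)) (+-identityʳ (s₂ m)))

s₂-2^+1 : ∀ a → 0 < a → s₂ (2 ^ a + 1) ≡ 2
s₂-2^+1 a 0<a = trans (cong s₂ (cong (_+ 1) (sym (*-identityʳ (2 ^ a)))))
                      (s₂-concat a 1 1 (^-monoʳ-< 2 (s≤s (s≤s z≤n)) {0} {a} 0<a))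

s₂-complement : ∀ a b c → b + c ≡ ones a → s₂ b + s₂ c ≡ a
s₂-complement zero zero zero _ = refl
s₂-complement (suc a) b c b+c≡ones with evenOdd b | evenOdd c
... | even x | even y = ⊥-elim (odd≢even (ones a) (x + y) (trans (sym b+c≡ones) (sym (*-distribˡ-+ 2 x y))))
... | odd x | odd y = ⊥-elim (odd≢even (ones a) (suc (x + y)) (trans (sym b+c≡ones) (odd+odd x y)))
  where
  odd+odd : ∀ x y → (1 + 2 * x) + (1 + 2 * y) ≡ 2 * suc (x + y)
  odd+odd = solve-∀
... | odd x | even y = begin
  s₂ (1 + 2 * x) + s₂ (2 * y)  ≡⟨ cong₂ _+_ (s₂-double+1 x) (s₂-double y) ⟩
  suc (s₂ x + s₂ y)            ≡⟨ cong suc (s₂-complement a x y (halve x y (suc-injective b+c≡ones))) ⟩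
  suc a                        ∎
  where open ≡-Reasoning
... | even x | odd y = begin
  s₂ (2 * x) + s₂ (1 + 2 * y)  ≡⟨ cong₂ _+_ (s₂-double x) (s₂-double+1 y) ⟩
  s₂ x + suc (s₂ y)            ≡⟨ +-suc (s₂ x) (s₂ y) ⟩
  suc (s₂ x + s₂ y)            ≡⟨ cong suc (s₂-complement a x y (halve x y (suc-injective (trans (sym (+-suc (2 * x) (2 * y))) b+c≡ones)))) ⟩
  suc a                        ∎
  where open ≡-Reasoning

s₂-ones-*-suc : ∀ c n → n < 2 ^ c → s₂ (ones c * suc n) ≡ c
s₂-ones-*-suc c n n<2^c = begin
  s₂ (ones c * suc n)      ≡⟨ cong s₂ split ⟩
  s₂ (2 ^ c * n + R)       ≡⟨ s₂-concat c n R R<2^c ⟩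
  s₂ n + s₂ R              ≡⟨ +-comm (s₂ n) (s₂ R) ⟩
  s₂ R + s₂ n              ≡⟨ s₂-complement c R n R+n≡ones ⟩
  c                        ∎
  where
  open ≡-Reasoning
  R : ℕ
  R = ones c ∸ n
  R+n≡ones : R + n ≡ ones c
  R+n≡ones = m∸n+n≡m (≤-pred (subst (n <_) (sym (suc-ones c)) n<2^c))
  R<2^c : R < 2 ^ c
  R<2^c = ≤-<-trans (m∸n≤m (ones c) n) (ones<2^ c)
  rearrange : ∀ R n → (R + n) * suc n ≡ suc (R + n) * n + R
  rearrange = solve-∀
  split : ones c * suc n ≡ 2 ^ c * n + R
  split = begin
    ones c * suc n           ≡⟨ cong (_* suc n) R+n≡ones ⟨
    (R + n) * suc n          ≡⟨ rearrange R n ⟩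
    suc (R + n) * n + R      ≡⟨ cong (λ x → suc x * n + R) R+n≡ones ⟩
    suc (ones c) * n + R     ≡⟨ cong (λ x → x * n + R) (suc-ones c) ⟩
    2 ^ c * n + R            ∎

s₂-*-2^+1 : ∀ {k} c h l → l < 2 ^ c → k ≡ 2 ^ c * h + l → s₂ (k * (2 ^ c + 1)) ≡ s₂ (k + h) + s₂ l
s₂-*-2^+1 c h l l<2^c refl = trans (cong s₂ (shift-add (2 ^ c) h l)) (s₂-concat c (2 ^ c * h + l + h) l l<2^c)
  where
  shift-add : ∀ x h l → (x * h + l) * (x + 1) ≡ x * (x * h + l + h) + l
  shift-add = solve-∀

-- k (2^c − 1) = 2^c K + (2^c − 1 − l), and the last summand is the c-bit complement of l.
s₂-*-ones : ∀ {k} c h l K → suc l < 2 ^ c → k ≡ 2 ^ c * h + suc l → K + suc h ≡ k →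
            s₂ (k * ones c) + s₂ l ≡ s₂ K + c
s₂-*-ones {k} c h l K 1+l<2^c refl K+1+h≡k = begin
  s₂ (k * ones c) + s₂ l       ≡⟨ cong (λ x → s₂ x + s₂ l) k*ones≡ ⟩
  s₂ (2 ^ c * K + R) + s₂ l    ≡⟨ cong (_+ s₂ l) (s₂-concat c K R R<2^c) ⟩
  s₂ K + s₂ R + s₂ l           ≡⟨ +-assoc (s₂ K) (s₂ R) (s₂ l) ⟩
  s₂ K + (s₂ R + s₂ l)         ≡⟨ cong (s₂ K +_) (s₂-complement c R l R+l≡ones) ⟩
  s₂ K + c                     ∎
  where
  open ≡-Reasoning
  regroup : ∀ x K R h l → x * K + R + (x * h + suc l) ≡ x * K + x * h + suc (R + l)
  regroup = solve-∀
  collect : ∀ x K h → x * K + x * h + x ≡ x * (K + suc h)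
  collect = solve-∀
  l<ones : l < ones c
  l<ones = ≤-pred (subst (suc l <_) (sym (suc-ones c)) 1+l<2^c)
  R : ℕ
  R = ones c ∸ l
  R+l≡ones : R + l ≡ ones c
  R+l≡ones = m∸n+n≡m (<⇒≤ l<ones)
  R<2^c : R < 2 ^ c
  R<2^c = ≤-<-trans (m∸n≤m (ones c) l) (ones<2^ c)
  k*ones≡ : k * ones c ≡ 2 ^ c * K + R
  k*ones≡ = +-cancelʳ-≡ k _ _ (sym (begin
    2 ^ c * K + R + k                    ≡⟨ regroup (2 ^ c) K R h l ⟩
    2 ^ c * K + 2 ^ c * h + suc (R + l)  ≡⟨ cong (λ x → 2 ^ c * K + 2 ^ c * h + suc x) R+l≡ones ⟩
    2 ^ c * K + 2 ^ c * h + suc (ones c) ≡⟨ cong (2 ^ c * K + 2 ^ c * h +_) (suc-ones c) ⟩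
    2 ^ c * K + 2 ^ c * h + 2 ^ c        ≡⟨ collect (2 ^ c) K h ⟩
    2 ^ c * (K + suc h)                  ≡⟨ cong (2 ^ c *_) K+1+h≡k ⟩
    2 ^ c * k                            ≡⟨ cong (_* k) (suc-ones c) ⟨
    suc (ones c) * k                     ≡⟨ *-comm (suc (ones c)) k ⟩
    k * suc (ones c)                     ≡⟨ *-suc k (ones c) ⟩
    k + k * ones c                       ≡⟨ +-comm k (k * ones c) ⟩
    k * ones c + k                       ∎))

-- The least element of 𝒩_k

least-witness : ∀ {P : ℕ → Set} → Decidable P → ∀ n → P n → ∃[ m ] (m ≤ n × P m × (∀ i → i < m → ¬ P i))
least-witness {P} P? = <-rec _ search
  where
  search : ∀ n → (∀ {m} → m < n → P m → ∃[ l ] (l ≤ m × P l × (∀ i → i < l → ¬ P i))) →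
           P n → ∃[ l ] (l ≤ n × P l × (∀ i → i < l → ¬ P i))
  search n rec Pn with anyUpTo? P? n
  ... | no none = n , ≤-refl , Pn , λ i i<n Pi → none (i , i<n , Pi)
  ... | yes (m , m<n , Pm) with rec m<n Pm
  ...   | l , l≤m , Pl , below-l = l , ≤-trans l≤m (<⇒≤ m<n) , Pl , below-l

IsF-unique : ∀ k {m m′} → IsF k m → IsF k m′ → m ≡ m′
IsF-unique k {m} {m′} (hit , below) (hit′ , below′) with <-cmp m m′
... | tri< m<m′ _ _ = ⊥-elim (1+n≢0 (trans (sym hit) (below′ m m<m′)))
... | tri≈ _ m≡m′ _ = m≡m′
... | tri> _ _ m′<m = ⊥-elim (1+n≢0 (trans (sym hit′) (below m′ m′<m)))

least-IsF : ∀ k n → t (k * n) ≡ 1 → ∃[ m ] (m ≤ n × IsF k m)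
least-IsF k n hit with least-witness (λ i → t (k * i) ≟ 1) n hit
... | m , m≤n , hit-m , below-m = m , m≤n , hit-m , λ i i<m → t≢1⇒t≡0 (k * i) (below-m i i<m)

t-double : ∀ k n → t (2 * k * n) ≡ t (k * n)
t-double k n = cong (_% 2) (trans (cong s₂ (*-assoc 2 k n)) (s₂-double (k * n)))

IsF-double : ∀ k m → IsF (2 * k) m ⇔ IsF k m
IsF-double k m = mk⇔
  (λ (hit , below) → trans (sym (t-double k m)) hit , λ n n<m → trans (sym (t-double k n)) (below n n<m))
  (λ (hit , below) → trans (t-double k m) hit , λ n n<m → trans (t-double k n) (below n n<m))

IsF-1 : IsF 1 1
IsF-1 = refl , λ { zero _ → refl ; (suc n) (s≤s ()) }

IsF-3 : IsF 3 7
IsF-3 = refl , below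
  where
  below : ∀ n → n < 7 → t (3 * n) ≡ 0
  below 0 _ = refl
  below 1 _ = refl
  below 2 _ = refl
  below 3 _ = refl
  below 4 _ = refl
  below 5 _ = refl
  below 6 _ = refl
  below (suc (suc (suc (suc (suc (suc (suc n))))))) (s≤s (s≤s (s≤s (s≤s (s≤s (s≤s (s≤s ())))))))

IsF-2 : IsF 2 1
IsF-4 : IsF 4 1
IsF-6 : IsF 6 7
IsF-2 = Equivalence.from (IsF-double 1 1) IsF-1
IsF-4 = Equivalence.from (IsF-double 2 1) IsF-2
IsF-6 = Equivalence.from (IsF-double 3 7) IsF-3

-- The exceptional families

IsF-2^r+1 : ∀ r → 2 ≤ r → IsF (2 ^ r + 1) (2 ^ r + 1)
IsF-2^r+1 (suc r) (s≤s 1≤r) = odious⇒t≡1 (k * k) square-odious , below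
  where
  X k : ℕ
  X = 2 ^ suc r
  k = X + 1
  1<X : 1 < X
  1<X = ^-monoʳ-< 2 (s≤s (s≤s z≤n)) {0} {suc r} z<s
  square-odious : Odious (k * k)
  square-odious = cong parity (begin
    s₂ (k * k)                        ≡⟨ cong s₂ (square (2 ^ r)) ⟩
    s₂ (X * (2 * (2 ^ r + 1)) + 1)    ≡⟨ s₂-concat (suc r) (2 * (2 ^ r + 1)) 1 1<X ⟩
    s₂ (2 * (2 ^ r + 1)) + 1          ≡⟨ cong (_+ 1) (s₂-double (2 ^ r + 1)) ⟩
    s₂ (2 ^ r + 1) + 1                ≡⟨ cong (_+ 1) (s₂-2^+1 r 1≤r) ⟩
    3                                 ∎)
    where
    open ≡-Reasoning
    square : ∀ y → (2 * y + 1) * (2 * y + 1) ≡ 2 * y * (2 * (y + 1)) + 1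
    square = solve-∀
  below : ∀ n → n < k → t (k * n) ≡ 0
  below n n<k with m≤n⇒m<n∨m≡n (≤-pred (subst (n <_) (+-comm X 1) n<k))
  ... | inj₁ n<X = evil⇒t≡0 (k * n) (begin
    parity (s₂ (k * n))        ≡⟨ cong (λ x → parity (s₂ x)) (shift-add X n) ⟩
    parity (s₂ (X * n + n))    ≡⟨ cong parity (s₂-concat (suc r) n n n<X) ⟩
    parity (s₂ n + s₂ n)       ≡⟨ parity-+-self (s₂ n) ⟩
    0ℙ                         ∎)
    where
    open ≡-Reasoning
    shift-add : ∀ x n → (x + 1) * n ≡ x * n + n
    shift-add = solve-∀
  ... | inj₂ refl = evil⇒t≡0 (k * X) (cong parity (begin
    s₂ (k * X)             ≡⟨ cong s₂ (shift (2 ^ suc r)) ⟩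
    s₂ (X * k + 0)         ≡⟨ s₂-concat (suc r) k 0 (m^n>0 2 (suc r)) ⟩
    s₂ k + 0               ≡⟨ cong (_+ 0) (s₂-2^+1 (suc r) z<s) ⟩
    2                      ∎))
    where
    open ≡-Reasoning
    shift : ∀ x → (x + 1) * x ≡ x * (x + 1) + 0
    shift = solve-∀

IsF-ones : ∀ e → parity e ≡ 0ℙ → IsF (ones (2 + e)) (ones (2 + e) + 4)
IsF-ones e e-even = odious⇒t≡1 (k * (k + 4)) k*[X+3]-odious , below
  where
  c k o X : ℕ
  c = 2 + e
  k = ones c
  o = ones e
  X = 2 ^ c
  open ≡-Reasoning
  <2^c : ∀ {m} → m ≤ k → m < X
  <2^c {m} m≤k = subst (m <_) (suc-ones c) (s≤s m≤k)
  top-split : ∀ o → let k = 1 + 2 * (1 + 2 * o) in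
              k * (k + 4) ≡ suc k * (suc k + 1) + (1 + 2 * (2 * o))
  top-split = solve-∀
  s₂-k*[X+3] : s₂ (k * (k + 4)) ≡ 3 + e
  s₂-k*[X+3] = begin
    s₂ (k * (k + 4))                             ≡⟨ cong s₂ (top-split o) ⟩
    s₂ (suc k * (suc k + 1) + (1 + 2 * (2 * o))) ≡⟨ cong (λ x → s₂ (x * (x + 1) + (1 + 2 * (2 * o)))) (suc-ones c) ⟩
    s₂ (X * (X + 1) + (1 + 2 * (2 * o)))         ≡⟨ s₂-concat c (X + 1) _ (<2^c (s≤s (*-monoʳ-≤ 2 (n≤1+n (2 * o))))) ⟩
    s₂ (X + 1) + s₂ (1 + 2 * (2 * o))            ≡⟨ cong₂ _+_ (s₂-2^+1 c z<s) (s₂-double+1 (2 * o)) ⟩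
    2 + suc (s₂ (2 * o))                         ≡⟨ cong (3 +_) (trans (s₂-double o) (s₂-ones e)) ⟩
    3 + e                                        ∎
  k*[X+3]-odious : Odious (k * (k + 4))
  k*[X+3]-odious = trans (cong parity s₂-k*[X+3]) (trans (ℙ.+-homo-+ 1 e) (cong (1ℙ ℙ.+_) e-even))
  mid-split : ∀ o → let k = 1 + 2 * (1 + 2 * o) in
              k * (2 + suc k) ≡ suc k * suc k + 2 * (1 + 2 * o)
  mid-split = solve-∀
  s₂-k*[X+2] : s₂ (k * (2 + X)) ≡ c
  s₂-k*[X+2] = begin
    s₂ (k * (2 + X))                    ≡⟨ cong (λ x → s₂ (k * (2 + x))) (suc-ones c) ⟨
    s₂ (k * (2 + suc k))                ≡⟨ cong s₂ (mid-split o) ⟩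
    s₂ (suc k * suc k + 2 * (1 + 2 * o)) ≡⟨ cong (λ x → s₂ (x * x + 2 * (1 + 2 * o))) (suc-ones c) ⟩
    s₂ (X * X + 2 * (1 + 2 * o))        ≡⟨ s₂-concat c X _ (<2^c (n≤1+n _)) ⟩
    s₂ X + s₂ (2 * (1 + 2 * o))         ≡⟨ cong₂ _+_ (s₂-2^ c) (trans (s₂-double (1 + 2 * o)) (s₂-double+1 o)) ⟩
    1 + (1 + s₂ o)                      ≡⟨ cong (2 +_) (s₂-ones e) ⟩
    c                                   ∎
  s₂-k*[X+1] : s₂ (k * (1 + X)) ≡ s₂ k + s₂ k
  s₂-k*[X+1] = trans (cong s₂ (shift-add k X)) (s₂-concat c k k (ones<2^ c))
    where
    shift-add : ∀ k x → k * (1 + x) ≡ x * k + k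
    shift-add = solve-∀
  n<3+X : ∀ {n} → n < k + 4 → n < 3 + X
  n<3+X {n} n<k+4 = subst (n <_) (trans (+-comm k 4) (cong (3 +_) (suc-ones c))) n<k+4
  below : ∀ n → n < k + 4 → t (k * n) ≡ 0
  below n n<k+4 with m≤n⇒m<n∨m≡n (≤-pred (n<3+X n<k+4))
  ... | inj₂ refl = evil⇒t≡0 (k * n) (trans (cong parity s₂-k*[X+2]) e-even)
  ... | inj₁ n<2+X with m≤n⇒m<n∨m≡n (≤-pred n<2+X)
  ...   | inj₂ refl = evil⇒t≡0 (k * n) (trans (cong parity s₂-k*[X+1]) (parity-+-self (s₂ k)))
  ...   | inj₁ n<1+X with n
  ...     | zero = evil⇒t≡0 (k * 0) (cong (λ x → parity (s₂ x)) (*-zeroʳ k))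
  ...     | suc n′ = evil⇒t≡0 (k * suc n′) (trans (cong parity (s₂-ones-*-suc c n′ (≤-pred n<1+X))) e-even)

-- Odd k outside the exceptional families

data LeadingOnes : ℕ → Set where
  all-ones       : ∀ a → LeadingOnes (ones a)
  ones-then-zero : ∀ p U₀ W → W < 2 ^ p → LeadingOnes (2 ^ suc p * ones (suc U₀) + W)

leadingOnes : ∀ k → LeadingOnes k
leadingOnes = binary-induction LeadingOnes (all-ones 0) double double+1
  where
  double : ∀ q → LeadingOnes q → LeadingOnes (2 * q)
  double _ (all-ones zero) = all-ones 0
  double _ (all-ones (suc a)) = subst LeadingOnes (shift (ones (suc a))) (ones-then-zero 0 a 0 z<s)
    where
    shift : ∀ x → 2 * 1 * x + 0 ≡ 2 * x
    shift = solve-∀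
  double _ (ones-then-zero p U₀ W W<2^p) =
    subst LeadingOnes (shift (2 ^ suc p) (ones (suc U₀)) W) (ones-then-zero (suc p) U₀ (2 * W) (*-monoʳ-< 2 W<2^p))
    where
    shift : ∀ y a w → 2 * y * a + 2 * w ≡ 2 * (y * a + w)
    shift = solve-∀
  double+1 : ∀ q → LeadingOnes q → LeadingOnes (1 + 2 * q)
  double+1 _ (all-ones a) = all-ones (suc a)
  double+1 _ (ones-then-zero p U₀ W W<2^p) =
    subst LeadingOnes (shift (2 ^ suc p) (ones (suc U₀)) W) (ones-then-zero (suc p) U₀ (1 + 2 * W) 1+2W<2^1+p)
    where
    shift : ∀ y a w → 2 * y * a + (1 + 2 * w) ≡ 1 + 2 * (y * a + w)
    shift = solve-∀
    1+2W<2^1+p : 1 + 2 * W < 2 * 2 ^ p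
    1+2W<2^1+p = subst (_≤ 2 * 2 ^ p) (*-suc 2 W) (*-monoʳ-≤ 2 W<2^p)

data TrailingOnes : ℕ → Set where
  ones-after : ∀ L M → TrailingOnes (2 ^ suc (suc L) * M + ones (suc L))

trailingOnes : ∀ W → parity W ≡ 1ℙ → TrailingOnes W
trailingOnes = binary-induction P (λ ()) double double+1
  where
  P : ℕ → Set
  P W = parity W ≡ 1ℙ → TrailingOnes W
  double : ∀ q → P q → P (2 * q)
  double q _ 2q-odd with () ← trans (sym (parity-double q)) 2q-odd
  double+1 : ∀ q → P q → P (1 + 2 * q)
  double+1 q ih _ with parity q in q-parity
  ... | 1ℙ with ih refl
  ...   | ones-after L M = subst TrailingOnes (shift (2 ^ suc (suc L)) M (ones L)) (ones-after (suc L) M)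
    where
    shift : ∀ y m o → 2 * y * m + (1 + 2 * (1 + 2 * o)) ≡ 1 + 2 * (y * m + (1 + 2 * o))
    shift = solve-∀
  double+1 q ih _ | 0ℙ with evenOdd q
  ... | even r = subst TrailingOnes (shift r) (ones-after 0 r)
    where
    shift : ∀ r → 4 * r + 1 ≡ 1 + 2 * (2 * r)
    shift = solve-∀
  ... | odd r with () ← trans (sym (parity-double+1 r)) q-parity

twoAdic : ∀ n → 0 < n → ∃[ z ] ∃[ q ] (n ≡ 2 ^ z * (1 + 2 * q))
twoAdic = binary-induction P (λ ()) double double+1
  where
  P : ℕ → Set
  P n = 0 < n → ∃[ z ] ∃[ q ] (n ≡ 2 ^ z * (1 + 2 * q))
  double : ∀ n → P n → P (2 * n)
  double zero _ ()
  double (suc n) ih _ with ih z<s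
  ... | z , q , eq = suc z , q , trans (cong (2 *_) eq) (sym (*-assoc 2 (2 ^ z) (1 + 2 * q)))
  double+1 : ∀ n → P n → P (1 + 2 * n)
  double+1 n _ _ = 0 , n , sym (+-identityʳ (1 + 2 * n))

OddWitness : ℕ → Set
OddWitness k = ∃[ n ] (n < k × Odious (k * n))

TwoPowPlus1 : ℕ → Set
TwoPowPlus1 k = ∃[ r ] (r ≥ 2 × k ≡ 2 ^ r + 1)

lowPart : ℕ → ℕ → ℕ
lowPart L₀ M = 2 ^ suc (suc L₀) * M + ones (suc L₀)

-- With U = U₀ + 1 and L = L₀ + 1, shape p U₀ L₀ M = 2^(p+1) (2^U − 1) + w where
-- w = lowPart L₀ M = 2^(L+1) M + 2^L − 1: in binary, a block of U ones, a zero at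
-- position p (the bound w < 2^p is a parameter of Shape), then w, which ends in a
-- zero followed by L ones.
shape : ℕ → ℕ → ℕ → ℕ → ℕ
shape p U₀ L₀ M = 2 ^ suc p * ones (suc U₀) + lowPart L₀ M

parity-shape : ∀ p a W → parity (2 ^ suc p * a + W) ≡ parity W
parity-shape p a W = trans (cong (λ x → parity (x + W)) (*-assoc 2 (2 ^ p) a)) (parity-double-+ (2 ^ p * a) W)

module Shape (p U₀ L₀ M : ℕ) (W<2^p : lowPart L₀ M < 2 ^ p) where
  U L Y W W′ k : ℕ
  U = suc U₀
  L = suc L₀
  Y = 2 ^ suc p
  W = lowPart L₀ M
  W′ = 2 ^ suc L * M + 2 * ones L₀
  k = shape p U₀ L₀ M

  W<Y : W < Y
  W<Y = <-trans W<2^p (2^<2^suc p)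

  W≡suc-W′ : W ≡ suc W′
  W≡suc-W′ = +-suc (2 ^ suc L * M) (2 * ones L₀)

  W′<Y : W′ < Y
  W′<Y = <-trans (subst (W′ <_) (sym W≡suc-W′) (n<1+n W′)) W<Y

  s₂-W : s₂ W ≡ s₂ M + L
  s₂-W = trans (s₂-concat (suc L) M (ones L) (ones<2^suc L)) (cong (s₂ M +_) (s₂-ones L))

  s₂-W′ : s₂ W′ ≡ s₂ M + L₀
  s₂-W′ = trans (s₂-concat (suc L) M (2 * ones L₀) (<-trans (n<1+n _) (ones<2^suc L)))
                (cong (s₂ M +_) (trans (s₂-double (ones L₀)) (s₂-ones L₀)))

  s₂-k : s₂ k ≡ U + (s₂ M + L)
  s₂-k = trans (s₂-concat (suc p) (ones U) W W<Y) (cong₂ _+_ (s₂-ones U) s₂-W)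

  2^L≤2^p : 2 ^ L ≤ 2 ^ p
  2^L≤2^p = subst (_≤ 2 ^ p) (suc-ones L) (≤-<-trans (m≤n+m (ones L) (2 ^ suc L * M)) W<2^p)

  1≤W : 1 ≤ W
  1≤W = subst (1 ≤_) (sym W≡suc-W′) (s≤s z≤n)

  k≡2^p*2A+W : k ≡ 2 ^ p * (2 * ones U) + W
  k≡2^p*2A+W = cong (_+ W) (swap (2 ^ p) (ones U))
    where
    swap : ∀ x a → 2 * x * a ≡ x * (2 * a)
    swap = solve-∀

  2^p+1<k : 2 ^ p + 1 < k
  2^p+1<k = begin-strict
    2 ^ p + 1                    ≤⟨ +-monoʳ-≤ (2 ^ p) (m^n>0 2 p) ⟩
    2 ^ p + 2 ^ p                ≡⟨ cong (2 ^ p +_) (+-identityʳ (2 ^ p)) ⟨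
    2 * 2 ^ p                    ≡⟨ *-comm 2 (2 ^ p) ⟩
    2 ^ p * 2                    ≤⟨ *-monoʳ-≤ (2 ^ p) (*-monoʳ-≤ 2 {1} {ones U} (s≤s z≤n)) ⟩
    2 ^ p * (2 * ones U)         <⟨ m<m+n (2 ^ p * (2 * ones U)) 1≤W ⟩
    2 ^ p * (2 * ones U) + W     ≡⟨ k≡2^p*2A+W ⟨
    k                            ∎
    where open ≤-Reasoning

  low low′ : ℕ → ℕ
  low x = Y * ones x + W
  low′ x = Y * ones x + W′

  k≡2^[p+1+x]*h+low : ∀ x h → ones U ≡ 2 ^ x * h + ones x → k ≡ 2 ^ (suc p + x) * h + low x
  k≡2^[p+1+x]*h+low x h ones-U≡ = begin
    Y * ones U + W                 ≡⟨ cong (λ a → Y * a + W) ones-U≡ ⟩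
    Y * (2 ^ x * h + ones x) + W   ≡⟨ regroup Y (2 ^ x) h (ones x) W ⟩
    Y * 2 ^ x * h + low x          ≡⟨ cong (λ y → y * h + low x) (^-distribˡ-+-* 2 (suc p) x) ⟨
    2 ^ (suc p + x) * h + low x    ∎
    where
    open ≡-Reasoning
    regroup : ∀ y x h o w → y * (x * h + o) + w ≡ y * x * h + (y * o + w)
    regroup = solve-∀

  low<2^[p+1+x] : ∀ x → low x < 2 ^ (suc p + x)
  low<2^[p+1+x] x = begin-strict
    Y * ones x + W         <⟨ +-monoʳ-< (Y * ones x) W<Y ⟩
    Y * ones x + Y         ≡⟨ +-comm (Y * ones x) Y ⟩
    Y + Y * ones x         ≡⟨ *-suc Y (ones x) ⟨
    Y * suc (ones x)       ≡⟨ cong (Y *_) (suc-ones x) ⟩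
    Y * 2 ^ x              ≡⟨ ^-distribˡ-+-* 2 (suc p) x ⟨
    2 ^ (suc p + x)        ∎
    where open ≤-Reasoning

  low≡suc-low′ : ∀ x → low x ≡ suc (low′ x)
  low≡suc-low′ x = trans (cong (Y * ones x +_) W≡suc-W′) (+-suc (Y * ones x) W′)

  suc-low′<2^[p+1+x] : ∀ x → suc (low′ x) < 2 ^ (suc p + x)
  suc-low′<2^[p+1+x] x = subst (_< 2 ^ (suc p + x)) (low≡suc-low′ x) (low<2^[p+1+x] x)

  k≡2^[p+1+x]*h+suc-low′ : ∀ x h → ones U ≡ 2 ^ x * h + ones x → k ≡ 2 ^ (suc p + x) * h + suc (low′ x)
  k≡2^[p+1+x]*h+suc-low′ x h ones-U≡ =
    trans (k≡2^[p+1+x]*h+low x h ones-U≡) (cong (2 ^ (suc p + x) * h +_) (low≡suc-low′ x))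

  s₂-low : ∀ x → s₂ (low x) ≡ x + (s₂ M + L)
  s₂-low x = trans (s₂-concat (suc p) (ones x) W W<Y) (cong₂ _+_ (s₂-ones x) s₂-W)

  s₂-low′ : ∀ x → s₂ (low′ x) ≡ x + (s₂ M + L₀)
  s₂-low′ x = trans (s₂-concat (suc p) (ones x) W′ W′<Y) (cong₂ _+_ (s₂-ones x) s₂-W′)

1≤W<2^p⇒0<p : ∀ {p W} → 1 ≤ W → W < 2 ^ p → 0 < p
1≤W<2^p⇒0<p {zero} (s≤s z≤n) (s≤s ())
1≤W<2^p⇒0<p {suc p} _ _ = z<s

witness-L-odd : ∀ p U₀ L₀ M (W<2^p : lowPart L₀ M < 2 ^ p) → parity (suc L₀) ≡ 1ℙ →
        OddWitness (shape p U₀ L₀ M) ⊎ TwoPowPlus1 (shape p U₀ L₀ M)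
witness-L-odd p U₀ L₀ M W<2^p L-odd = result
  where
  open Shape p U₀ L₀ M W<2^p
  open ≡-Reasoning
  c l : ℕ
  c = suc p + U₀
  l = low U₀
  k≡2^c+l : k ≡ 2 ^ c * 1 + l
  k≡2^c+l = k≡2^[p+1+x]*h+low U₀ 1 (ones-+ 1 U₀)
  suc-W : suc W ≡ 2 ^ suc L * M + 2 ^ L
  suc-W = trans (sym (+-suc (2 ^ suc L * M) (ones L))) (cong (2 ^ suc L * M +_) (suc-ones L))
  s₂-k+1 : s₂ (k + 1) ≡ U + (s₂ M + 1)
  s₂-k+1 = begin
    s₂ (k + 1)                       ≡⟨ cong s₂ (trans (+-assoc (Y * ones U) W 1) (cong (Y * ones U +_) (+-comm W 1))) ⟩
    s₂ (Y * ones U + suc W)          ≡⟨ s₂-concat (suc p) (ones U) (suc W) (≤-<-trans W<2^p (2^<2^suc p)) ⟩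
    s₂ (ones U) + s₂ (suc W)         ≡⟨ cong₂ _+_ (s₂-ones U) (cong s₂ suc-W) ⟩
    U + s₂ (2 ^ suc L * M + 2 ^ L)   ≡⟨ cong (U +_) (s₂-concat (suc L) M (2 ^ L) (2^<2^suc L)) ⟩
    U + (s₂ M + s₂ (2 ^ L))          ≡⟨ cong (λ x → U + (s₂ M + x)) (s₂-2^ L) ⟩
    U + (s₂ M + 1)                   ∎
  collect : ∀ u m l → (suc u + (m + 1)) + (u + (m + l)) ≡ l + 2 * (suc u + m)
  collect = solve-∀
  s₂-k*[2^c+1] : s₂ (k * (2 ^ c + 1)) ≡ L + 2 * (U + s₂ M)
  s₂-k*[2^c+1] = begin
    s₂ (k * (2 ^ c + 1))    ≡⟨ s₂-*-2^+1 c 1 l (low<2^[p+1+x] U₀) k≡2^c+l ⟩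
    s₂ (k + 1) + s₂ l       ≡⟨ cong₂ _+_ s₂-k+1 (s₂-low U₀) ⟩
    (U + (s₂ M + 1)) + (U₀ + (s₂ M + L)) ≡⟨ collect U₀ (s₂ M) L ⟩
    L + 2 * (U + s₂ M)      ∎
  result : OddWitness k ⊎ TwoPowPlus1 k
  result with 1 <? l
  ... | yes 1<l = inj₁ (2 ^ c + 1 , 2^c+1<k , odious)
    where
    2^c+1<k : 2 ^ c + 1 < k
    2^c+1<k = subst₂ _<_ (cong (_+ 1) (*-identityʳ (2 ^ c))) (sym k≡2^c+l) (+-monoʳ-< (2 ^ c * 1) 1<l)
    odious : Odious (k * (2 ^ c + 1))
    odious = trans (cong parity s₂-k*[2^c+1]) (trans (parity-+-double L (U + s₂ M)) L-odd)
  ... | no 1≮l = inj₂ (c , s≤s (≤-trans (1≤W<2^p⇒0<p 1≤W W<2^p) (m≤m+n p U₀)) , k≡2^c+1)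
    where
    l≡1 : l ≡ 1
    l≡1 = ≤-antisym (≮⇒≥ 1≮l) (≤-trans 1≤W (m≤n+m W (Y * ones U₀)))
    k≡2^c+1 : k ≡ 2 ^ c + 1
    k≡2^c+1 = trans k≡2^c+l (cong₂ _+_ (*-identityʳ (2 ^ c)) l≡1)

witness-p+U-even : ∀ p U₀ L₁ M (W<2^p : lowPart (suc L₁) M < 2 ^ p) → parity (p + suc U₀) ≡ 0ℙ →
        OddWitness (shape p U₀ (suc L₁) M)
witness-p+U-even p U₀ L₁ M W<2^p p+U-even = ones c , <k , odious
  where
  open Shape p U₀ (suc L₁) M W<2^p
  open ≡-Reasoning
  c R K : ℕ
  c = suc p + U₀
  R = 1 + 2 * (2 * ones L₁)
  K = Y * ones U + (2 ^ suc L * M + R)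
  k≡2^c+suc-low′ : k ≡ 2 ^ c * 1 + suc (low′ U₀)
  k≡2^c+suc-low′ = k≡2^[p+1+x]*h+suc-low′ U₀ 1 (ones-+ 1 U₀)
  <k : ones c < k
  <k = subst (ones c <_) (sym k≡2^c+suc-low′) (ones<2^*suc c 0 (suc (low′ U₀)))
  K+2≡k : K + 2 ≡ k
  K+2≡k = shift Y (ones U) (2 ^ suc L * M) (ones L₁)
    where
    shift : ∀ y a w o → y * a + (w + (1 + 2 * (2 * o))) + 2 ≡ y * a + (w + (1 + 2 * (1 + 2 * o)))
    shift = solve-∀
  R<ones-L : R < ones L
  R<ones-L = s≤s (*-monoʳ-< 2 (n<1+n (2 * ones L₁)))
  s₂-K : s₂ K ≡ U + (s₂ M + suc L₁)
  s₂-K = begin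
    s₂ K                                  ≡⟨ s₂-concat (suc p) (ones U) _ (<-trans (+-monoʳ-< (2 ^ suc L * M) R<ones-L) W<Y) ⟩
    s₂ (ones U) + s₂ (2 ^ suc L * M + R)  ≡⟨ cong (s₂ (ones U) +_) (s₂-concat (suc L) M R (<-trans R<ones-L (ones<2^suc L))) ⟩
    s₂ (ones U) + (s₂ M + s₂ R)           ≡⟨ cong₂ (λ x y → x + (s₂ M + y)) (s₂-ones U) (s₂-1+4*ones L₁) ⟩
    U + (s₂ M + suc L₁)                   ∎
  collect : ∀ p u m l → (suc u + (m + l)) + (suc p + u) ≡ (1 + (p + suc u)) + (u + (m + l))
  collect = solve-∀
  s₂-k*ones-c : s₂ (k * ones c) ≡ 1 + (p + U)
  s₂-k*ones-c = +-cancelʳ-≡ (s₂ (low′ U₀)) _ _ (begin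
    s₂ (k * ones c) + s₂ (low′ U₀)         ≡⟨ s₂-*-ones c 1 (low′ U₀) K (suc-low′<2^[p+1+x] U₀) k≡2^c+suc-low′ K+2≡k ⟩
    s₂ K + c                               ≡⟨ cong (_+ c) s₂-K ⟩
    (U + (s₂ M + suc L₁)) + c              ≡⟨ collect p U₀ (s₂ M) (suc L₁) ⟩
    (1 + (p + U)) + (U₀ + (s₂ M + suc L₁)) ≡⟨ cong ((1 + (p + U)) +_) (s₂-low′ U₀) ⟨
    (1 + (p + U)) + s₂ (low′ U₀)           ∎)
  odious : Odious (k * ones c)
  odious = trans (cong parity s₂-k*ones-c) (trans (ℙ.+-homo-+ 1 (p + U)) (cong (1ℙ ℙ.+_) p+U-even))

witness-U<L : ∀ p U₀ L₀ M (W<2^p : lowPart L₀ M < 2 ^ p) → parity (suc L₀) ≡ 0ℙ → suc U₀ < suc L₀ →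
        OddWitness (shape p U₀ L₀ M)
witness-U<L p U₀ L₀ M W<2^p L-even U<L = 2 ^ p + 1 , 2^p+1<k , odious
  where
  open Shape p U₀ L₀ M W<2^p
  A C′ : ℕ
  A = ones U
  C′ = 1 + 2 * (2 * ones U₀)
  2^U+1≤2^L : 2 ^ suc U ≤ 2 ^ L
  2^U+1≤2^L = ^-monoʳ-≤ 2 U<L
  2A≤2^U+1 : 2 * A ≤ 2 ^ suc U
  2A≤2^U+1 = subst (2 * A ≤_) (cong (λ x → 2 * (2 * x)) (suc-ones U₀))
                   (*-monoʳ-≤ 2 (s≤s (+-monoʳ-≤ (ones U₀) (n≤1+n (ones U₀ + 0)))))
  C′<2^L : C′ < 2 ^ L
  C′<2^L = ≤-trans (≤-reflexive (double-odd (ones U₀))) (≤-trans 2A≤2^U+1 2^U+1≤2^L)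
    where
    double-odd : ∀ o → 2 + 2 * (2 * o) ≡ 2 * (1 + 2 * o)
    double-odd = solve-∀
  W+2A≡ : W + 2 * A ≡ 2 ^ L * (1 + 2 * M) + C′
  W+2A≡ = begin
    2 * 2 ^ L * M + ones L + 2 * (1 + 2 * ones U₀)  ≡⟨ regroup (2 ^ L) M (ones L) (ones U₀) ⟩
    2 * 2 ^ L * M + suc (ones L) + C′               ≡⟨ cong (λ x → 2 * 2 ^ L * M + x + C′) (suc-ones L) ⟩
    2 * 2 ^ L * M + 2 ^ L + C′                      ≡⟨ factor (2 ^ L) M C′ ⟩
    2 ^ L * (1 + 2 * M) + C′                        ∎
    where
    open ≡-Reasoning
    regroup : ∀ x m o u → 2 * x * m + o + 2 * (1 + 2 * u) ≡ 2 * x * m + suc o + (1 + 2 * (2 * u))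
    regroup = solve-∀
    factor : ∀ x m c → 2 * x * m + x + c ≡ x * (1 + 2 * m) + c
    factor = solve-∀
  W+2A<Y : W + 2 * A < Y
  W+2A<Y = subst (W + 2 * A <_) (cong (2 ^ p +_) (sym (+-identityʳ (2 ^ p))))
                 (+-mono-<-≤ W<2^p (≤-trans 2A≤2^U+1 (≤-trans 2^U+1≤2^L 2^L≤2^p)))
  s₂-k+2A : s₂ (k + 2 * A) ≡ U + ((1 + s₂ M) + (1 + U₀))
  s₂-k+2A = begin
    s₂ (k + 2 * A)                              ≡⟨ cong s₂ (+-assoc (Y * A) W (2 * A)) ⟩
    s₂ (Y * A + (W + 2 * A))                    ≡⟨ s₂-concat (suc p) A (W + 2 * A) W+2A<Y ⟩
    s₂ A + s₂ (W + 2 * A)                       ≡⟨ cong₂ _+_ (s₂-ones U) (cong s₂ W+2A≡) ⟩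
    U + s₂ (2 ^ L * (1 + 2 * M) + C′)           ≡⟨ cong (U +_) (s₂-concat L (1 + 2 * M) C′ C′<2^L) ⟩
    U + (s₂ (1 + 2 * M) + s₂ C′)                ≡⟨ cong₂ (λ x y → U + (x + y)) (s₂-double+1 M) (s₂-1+4*ones U₀) ⟩
    U + ((1 + s₂ M) + (1 + U₀))                 ∎
    where open ≡-Reasoning
  collect : ∀ u m l → (suc u + ((1 + m) + (1 + u))) + (m + l) ≡ (1 + l) + 2 * (suc u + m)
  collect = solve-∀
  s₂-k*[2^p+1] : s₂ (k * (2 ^ p + 1)) ≡ (1 + L) + 2 * (U + s₂ M)
  s₂-k*[2^p+1] = begin
    s₂ (k * (2 ^ p + 1))                          ≡⟨ s₂-*-2^+1 p (2 * A) W W<2^p k≡2^p*2A+W ⟩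
    s₂ (k + 2 * A) + s₂ W                         ≡⟨ cong₂ _+_ s₂-k+2A s₂-W ⟩
    (U + ((1 + s₂ M) + (1 + U₀))) + (s₂ M + L)    ≡⟨ collect U₀ (s₂ M) L ⟩
    (1 + L) + 2 * (U + s₂ M)                      ∎
    where open ≡-Reasoning
  odious : Odious (k * (2 ^ p + 1))
  odious = trans (cong parity s₂-k*[2^p+1]) (trans (parity-+-double (1 + L) (U + s₂ M)) (trans (ℙ.+-homo-+ 1 L) (cong (1ℙ ℙ.+_) L-even)))

-- With U = L + d and p = L + e, k = 2^(L+1) M′ + (2^L − 1); the parity of the
-- 2-adic valuation z of M′ decides which multiplier 2^c − 1 works.
module ShapeD (L₀ d e M : ℕ) (W<2^p : lowPart L₀ M < 2 ^ (suc L₀ + e)) where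
  open Shape (suc L₀ + e) (L₀ + d) L₀ M W<2^p public
  p B X M′ : ℕ
  p = suc L₀ + e
  B = ones L
  X = 2 ^ suc L
  M′ = 2 ^ e * ones U + M

  k≡XM′+B : k ≡ X * M′ + B
  k≡XM′+B = begin
    Y * ones U + (X * M + B)                    ≡⟨ cong (λ y → 2 * y * ones U + (X * M + B)) (^-distribˡ-+-* 2 L e) ⟩
    2 * (2 ^ L * 2 ^ e) * ones U + (X * M + B)  ≡⟨ regroup (2 ^ L) (2 ^ e) (ones U) M B ⟩
    X * M′ + B                                  ∎
    where
    open ≡-Reasoning
    regroup : ∀ x y a m b → 2 * (x * y) * a + (2 * x * m + b) ≡ 2 * x * (y * a + m) + b
    regroup = solve-∀

  s₂-M′ : s₂ M′ ≡ U + s₂ M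
  s₂-M′ = +-cancelʳ-≡ L _ _ (begin
    s₂ M′ + L          ≡⟨ cong (s₂ M′ +_) (s₂-ones L) ⟨
    s₂ M′ + s₂ B       ≡⟨ s₂-concat (suc L) M′ B (ones<2^suc L) ⟨
    s₂ (X * M′ + B)    ≡⟨ cong s₂ k≡XM′+B ⟨
    s₂ k               ≡⟨ s₂-k ⟩
    U + (s₂ M + L)     ≡⟨ +-assoc U (s₂ M) L ⟨
    U + s₂ M + L       ∎)
    where open ≡-Reasoning

  0<M′ : 0 < M′
  0<M′ = ≤-trans (*-mono-≤ (m^n>0 2 e) (s≤s z≤n)) (m≤m+n (2 ^ e * ones U) M)

  X≡2*suc-B : X ≡ 2 * suc B
  X≡2*suc-B = cong (2 *_) (sym (suc-ones L))

  module Adic (z q : ℕ) (M′≡ : M′ ≡ 2 ^ z * (1 + 2 * q)) where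
    T : ℕ
    T = 2 ^ z * (2 * q) + ones z

    s₂-T : s₂ T ≡ s₂ q + z
    s₂-T = trans (s₂-concat z (2 * q) (ones z) (ones<2^ z)) (cong₂ _+_ (s₂-double q) (s₂-ones z))

    suc-s₂-q : suc (s₂ q) ≡ U + s₂ M
    suc-s₂-q = begin
      suc (s₂ q)                  ≡⟨ s₂-double+1 q ⟨
      s₂ (1 + 2 * q)              ≡⟨ s₂-2^* z (1 + 2 * q) ⟨
      s₂ (2 ^ z * (1 + 2 * q))    ≡⟨ cong s₂ M′≡ ⟨
      s₂ M′                       ≡⟨ s₂-M′ ⟩
      U + s₂ M                    ∎
      where open ≡-Reasoning

    k≡XT+X+B : k ≡ X * T + (X + B)
    k≡XT+X+B = begin
      k                                     ≡⟨ k≡XM′+B ⟩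
      X * M′ + B                            ≡⟨ cong (λ m → X * m + B) M′≡ ⟩
      X * (2 ^ z * (1 + 2 * q)) + B         ≡⟨ cong (λ y → X * (y * (1 + 2 * q)) + B) (suc-ones z) ⟨
      X * (suc (ones z) * (1 + 2 * q)) + B  ≡⟨ regroup X (ones z) q B ⟩
      X * (suc (ones z) * (2 * q) + ones z) + (X + B)  ≡⟨ cong (λ y → X * (y * (2 * q) + ones z) + (X + B)) (suc-ones z) ⟩
      X * T + (X + B)                       ∎
      where
      open ≡-Reasoning
      regroup : ∀ x o q b → x * (suc o * (1 + 2 * q)) + b ≡ x * (suc o * (2 * q) + o) + (x + b)
      regroup = solve-∀

witness-L≤U-z-even : ∀ L₀ d e M (W<2^p : lowPart L₀ M < 2 ^ (suc L₀ + e)) z q →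
               ShapeD.M′ L₀ d e M W<2^p ≡ 2 ^ z * (1 + 2 * q) → parity z ≡ 0ℙ →
               parity (suc L₀ + e + suc (L₀ + d)) ≡ 1ℙ → OddWitness (shape (suc L₀ + e) (L₀ + d) L₀ M)
witness-L≤U-z-even L₀ d e M W<2^p z q M′≡ z-even p+U-odd = ones c , <k , odious
  where
  open ShapeD L₀ d e M W<2^p
  open Adic z q M′≡
  open ≡-Reasoning
  c K : ℕ
  c = suc p + d
  K = X * T + ones (suc L)
  k≡ : k ≡ 2 ^ c * B + suc (low′ d)
  k≡ = k≡2^[p+1+x]*h+suc-low′ d B (ones-+ L d)
  <k : ones c < k
  <k = subst (ones c <_) (sym k≡) (ones<2^*suc c (2 * ones L₀) (suc (low′ d)))
  K+suc-B≡k : K + suc B ≡ k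
  K+suc-B≡k = begin
    X * T + (1 + 2 * B) + suc B   ≡⟨ regroup (X * T) B ⟩
    X * T + (2 * suc B + B)       ≡⟨ cong (λ x → X * T + (x + B)) X≡2*suc-B ⟨
    X * T + (X + B)               ≡⟨ k≡XT+X+B ⟨
    k                             ∎
    where
    regroup : ∀ y b → y + (1 + 2 * b) + suc b ≡ y + (2 * suc b + b)
    regroup = solve-∀
  s₂-K : s₂ K ≡ s₂ q + z + suc L
  s₂-K = trans (s₂-concat (suc L) T (ones (suc L)) (ones<2^ (suc L))) (cong₂ _+_ s₂-T (s₂-ones (suc L)))
  shift-one : ∀ s z l c → s + z + suc l + c ≡ suc s + (z + l + c)
  shift-one = solve-∀
  collect : ∀ l₀ d e m z → suc (l₀ + d) + m + (z + suc l₀ + (suc (suc l₀ + e) + d)) ≡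
                           (2 + z + (suc l₀ + e + suc (l₀ + d))) + (d + (m + l₀))
  collect = solve-∀
  s₂-k*ones-c : s₂ (k * ones c) ≡ 2 + z + (p + U)
  s₂-k*ones-c = +-cancelʳ-≡ (s₂ (low′ d)) _ _ (begin
    s₂ (k * ones c) + s₂ (low′ d)      ≡⟨ s₂-*-ones c B (low′ d) K (suc-low′<2^[p+1+x] d) k≡ K+suc-B≡k ⟩
    s₂ K + c                           ≡⟨ cong (_+ c) s₂-K ⟩
    s₂ q + z + suc L + c               ≡⟨ shift-one (s₂ q) z L c ⟩
    suc (s₂ q) + (z + L + c)           ≡⟨ cong (_+ (z + L + c)) suc-s₂-q ⟩
    U + s₂ M + (z + L + c)             ≡⟨ collect L₀ d e (s₂ M) z ⟩
    (2 + z + (p + U)) + (d + (s₂ M + L₀))  ≡⟨ cong ((2 + z + (p + U)) +_) (s₂-low′ d) ⟨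
    (2 + z + (p + U)) + s₂ (low′ d)    ∎)
  odious : Odious (k * ones c)
  odious = trans (cong parity s₂-k*ones-c) (trans (ℙ.+-homo-+ z (p + U)) (cong₂ ℙ._+_ z-even p+U-odd))

witness-L<U-z-odd : ∀ L₀ d′ e M (W<2^p : lowPart L₀ M < 2 ^ (suc L₀ + e)) z q →
                    ShapeD.M′ L₀ (suc d′) e M W<2^p ≡ 2 ^ z * (1 + 2 * q) → parity z ≡ 1ℙ →
                    parity (suc L₀ + e + suc (L₀ + suc d′)) ≡ 1ℙ →
                    OddWitness (shape (suc L₀ + e) (L₀ + suc d′) L₀ M)
witness-L<U-z-odd L₀ d′ e M W<2^p z q M′≡ z-odd p+U-odd = ones c , <k , odious
  where
  open ShapeD L₀ (suc d′) e M W<2^p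
  open Adic z q M′≡
  open ≡-Reasoning
  c K : ℕ
  c = suc p + d′
  K = X * T + B
  ones-U≡ : ones U ≡ 2 ^ d′ * ones (suc L) + ones d′
  ones-U≡ = trans (cong (λ x → ones (suc x)) (+-suc L₀ d′)) (ones-+ (suc L) d′)
  k≡ : k ≡ 2 ^ c * ones (suc L) + suc (low′ d′)
  k≡ = k≡2^[p+1+x]*h+suc-low′ d′ (ones (suc L)) ones-U≡
  <k : ones c < k
  <k = subst (ones c <_) (sym k≡) (ones<2^*suc c (2 * B) (suc (low′ d′)))
  K+h≡k : K + suc (ones (suc L)) ≡ k
  K+h≡k = begin
    X * T + B + suc (1 + 2 * B)   ≡⟨ regroup (X * T) B ⟩
    X * T + (2 * suc B + B)       ≡⟨ cong (λ x → X * T + (x + B)) X≡2*suc-B ⟨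
    X * T + (X + B)               ≡⟨ k≡XT+X+B ⟨
    k                             ∎
    where
    regroup : ∀ y b → y + b + suc (1 + 2 * b) ≡ y + (2 * suc b + b)
    regroup = solve-∀
  s₂-K : s₂ K ≡ s₂ q + z + L
  s₂-K = trans (s₂-concat (suc L) T B (ones<2^suc L)) (cong₂ _+_ s₂-T (s₂-ones L))
  shift-one : ∀ s z l c → s + z + suc l + c ≡ suc s + (z + l + c)
  shift-one = solve-∀
  collect : ∀ l₀ d e m z → suc (l₀ + suc d) + m + (z + l₀ + (suc (suc l₀ + e) + d)) ≡
                           (1 + z + (suc l₀ + e + suc (l₀ + suc d))) + (d + (m + l₀))
  collect = solve-∀
  s₂-k*ones-c : s₂ (k * ones c) ≡ 1 + z + (p + U)
  s₂-k*ones-c = +-cancelʳ-≡ (s₂ (low′ d′)) _ _ (begin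
    s₂ (k * ones c) + s₂ (low′ d′)     ≡⟨ s₂-*-ones c (ones (suc L)) (low′ d′) K (suc-low′<2^[p+1+x] d′) k≡ K+h≡k ⟩
    s₂ K + c                           ≡⟨ cong (_+ c) s₂-K ⟩
    s₂ q + z + suc L₀ + c              ≡⟨ shift-one (s₂ q) z L₀ c ⟩
    suc (s₂ q) + (z + L₀ + c)          ≡⟨ cong (_+ (z + L₀ + c)) suc-s₂-q ⟩
    U + s₂ M + (z + L₀ + c)            ≡⟨ collect L₀ d′ e (s₂ M) z ⟩
    (1 + z + (p + U)) + (d′ + (s₂ M + L₀))  ≡⟨ cong ((1 + z + (p + U)) +_) (s₂-low′ d′) ⟨
    (1 + z + (p + U)) + s₂ (low′ d′)   ∎)
  odious : Odious (k * ones c)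
  odious = trans (cong parity s₂-k*ones-c)
                 (trans (ℙ.+-homo-+ (1 + z) (p + U)) (cong₂ ℙ._+_ (trans (ℙ.+-homo-+ 1 z) (cong (1ℙ ℙ.+_) z-odd)) p+U-odd))

witness-L≡U-z-odd : ∀ L₀ e M (W<2^p : lowPart L₀ M < 2 ^ (suc L₀ + e)) z q →
                    ShapeD.M′ L₀ 0 e M W<2^p ≡ 2 ^ z * (1 + 2 * q) → parity z ≡ 1ℙ → parity (suc L₀) ≡ 0ℙ →
                    parity (suc L₀ + e + suc (L₀ + 0)) ≡ 1ℙ → OddWitness (shape (suc L₀ + e) (L₀ + 0) L₀ M)
witness-L≡U-z-odd L₀ e M W<2^p z q M′≡ z-odd L-even p+U-odd = ones p , <k , odious
  where
  open ShapeD L₀ zero e M W<2^p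
  open Adic z q M′≡
  open ≡-Reasoning
  K : ℕ
  K = X * T + 2 ^ L
  ones-U≡B : ones U ≡ B
  ones-U≡B = cong (λ x → ones (suc x)) (+-identityʳ L₀)
  k≡ : k ≡ 2 ^ p * (2 * ones U) + suc W′
  k≡ = trans k≡2^p*2A+W (cong (2 ^ p * (2 * ones U) +_) W≡suc-W′)
  <k : ones p < k
  <k = subst (ones p <_) (sym k≡) (ones<2^*suc p _ (suc W′))
  K+h≡k : K + suc (2 * ones U) ≡ k
  K+h≡k = begin
    X * T + 2 ^ L + suc (2 * ones U)   ≡⟨ cong₂ (λ x a → X * T + x + suc (2 * a)) (sym (suc-ones L)) ones-U≡B ⟩
    X * T + suc B + suc (2 * B)        ≡⟨ regroup (X * T) B ⟩
    X * T + (2 * suc B + B)            ≡⟨ cong (λ x → X * T + (x + B)) X≡2*suc-B ⟨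
    X * T + (X + B)                    ≡⟨ k≡XT+X+B ⟨
    k                                  ∎
    where
    regroup : ∀ y b → y + suc b + suc (2 * b) ≡ y + (2 * suc b + b)
    regroup = solve-∀
  s₂-K : s₂ K ≡ s₂ q + z + 1
  s₂-K = trans (s₂-concat (suc L) T (2 ^ L) (2^<2^suc L)) (cong₂ _+_ s₂-T (s₂-2^ L))
  shift-one : ∀ s z p → s + z + 1 + p ≡ suc s + (z + p)
  shift-one = solve-∀
  collect : ∀ l₀ m z p → suc (l₀ + 0) + m + (z + p) ≡ (1 + z + p) + (m + l₀)
  collect = solve-∀
  s₂-k*ones-p : s₂ (k * ones p) ≡ 1 + z + p
  s₂-k*ones-p = +-cancelʳ-≡ (s₂ W′) _ _ (begin
    s₂ (k * ones p) + s₂ W′        ≡⟨ s₂-*-ones p (2 * ones U) W′ K (subst (_< 2 ^ p) W≡suc-W′ W<2^p) k≡ K+h≡k ⟩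
    s₂ K + p                       ≡⟨ cong (_+ p) s₂-K ⟩
    s₂ q + z + 1 + p               ≡⟨ shift-one (s₂ q) z p ⟩
    suc (s₂ q) + (z + p)           ≡⟨ cong (_+ (z + p)) suc-s₂-q ⟩
    U + s₂ M + (z + p)             ≡⟨ collect L₀ (s₂ M) z p ⟩
    (1 + z + p) + (s₂ M + L₀)      ≡⟨ cong ((1 + z + p) +_) s₂-W′ ⟨
    (1 + z + p) + s₂ W′            ∎)
  p-odd : parity p ≡ 1ℙ
  p-odd = begin
    parity p                   ≡⟨ ℙ.+-identityʳ (parity p) ⟨
    parity p ℙ.+ 0ℙ            ≡⟨ cong (parity p ℙ.+_) (trans (cong (λ x → parity (suc x)) (+-identityʳ L₀)) L-even) ⟨
    parity p ℙ.+ parity U      ≡⟨ ℙ.+-homo-+ p U ⟨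
    parity (p + U)             ≡⟨ p+U-odd ⟩
    1ℙ                         ∎
  odious : Odious (k * ones p)
  odious = trans (cong parity s₂-k*ones-p)
                 (trans (ℙ.+-homo-+ (1 + z) p) (cong₂ ℙ._+_ (trans (ℙ.+-homo-+ 1 z) (cong (1ℙ ℙ.+_) z-odd)) p-odd))

witness-L≤U : ∀ L₀ d e M (W<2^p : lowPart L₀ M < 2 ^ (suc L₀ + e)) → parity (suc L₀) ≡ 0ℙ →
        parity (suc L₀ + e + suc (L₀ + d)) ≡ 1ℙ → OddWitness (shape (suc L₀ + e) (L₀ + d) L₀ M)
witness-L≤U L₀ d e M W<2^p L-even p+U-odd with twoAdic (ShapeD.M′ L₀ d e M W<2^p) (ShapeD.0<M′ L₀ d e M W<2^p)
... | z , q , M′≡ with parity z in z-parity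
...   | 0ℙ = witness-L≤U-z-even L₀ d e M W<2^p z q M′≡ z-parity p+U-odd
...   | 1ℙ with d
...     | zero = witness-L≡U-z-odd L₀ e M W<2^p z q M′≡ z-parity L-even p+U-odd
...     | suc d′ = witness-L<U-z-odd L₀ d′ e M W<2^p z q M′≡ z-parity p+U-odd

witness-L-even : ∀ p U₀ L₀ M (W<2^p : lowPart L₀ M < 2 ^ p) → parity (suc L₀) ≡ 0ℙ →
                 OddWitness (shape p U₀ L₀ M)
witness-L-even p U₀ (suc L₁) M W<2^p L-even with parity (p + suc U₀) in p+U-parity
... | 0ℙ = witness-p+U-even p U₀ L₁ M W<2^p p+U-parity
... | 1ℙ with suc U₀ <? suc (suc L₁)
...   | yes U<L = witness-U<L p U₀ (suc L₁) M W<2^p L-even U<L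
...   | no U≮L with m≤n⇒∃[o]m+o≡n {suc L₁} {U₀} (≤-pred (≮⇒≥ U≮L)) | m≤n⇒∃[o]m+o≡n {suc (suc L₁)} {p} (2^-reflects-≤ (Shape.2^L≤2^p p U₀ (suc L₁) M W<2^p))
...     | d , refl | e , refl = witness-L≤U (suc L₁) d e M W<2^p L-even p+U-parity

OddProfile : ℕ → Set
OddProfile k = k ≡ 1 ⊎ (∃[ h ] k ≡ ones (2 + 2 * h)) ⊎ TwoPowPlus1 k ⊎ OddWitness k

odd-profile : ∀ {k} → LeadingOnes k → parity k ≡ 1ℙ → OddProfile k
odd-profile (all-ones 1) _ = inj₁ refl
odd-profile (all-ones (suc (suc e))) _ with evenOdd e
... | even h = inj₂ (inj₁ (h , refl))
... | odd h = inj₂ (inj₂ (inj₂ (1 , s≤s (s≤s z≤n) , odious)))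
  where
  odious : Odious (ones (3 + 2 * h) * 1)
  odious = trans (cong (λ x → parity (s₂ x)) (*-identityʳ (ones (3 + 2 * h)))) (trans (cong parity (s₂-ones (3 + 2 * h))) (parity-double+1 h))
odd-profile (ones-then-zero p U₀ W W<2^p) k-odd with trailingOnes W (trans (sym (parity-shape p (ones (suc U₀)) W)) k-odd)
... | ones-after L₀ M with parity (suc L₀) in L-parity
...   | 0ℙ = inj₂ (inj₂ (inj₂ (witness-L-even p U₀ L₀ M W<2^p L-parity)))
...   | 1ℙ with witness-L-odd p U₀ L₀ M W<2^p L-parity
...     | inj₁ witness = inj₂ (inj₂ (inj₂ witness))
...     | inj₂ 2^r+1 = inj₂ (inj₂ (inj₁ 2^r+1))

-- The profile of f

FourPowMinus1 : ℕ → Set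
FourPowMinus1 k = ∃[ r ] (r ≥ 1 × k + 1 ≡ 2 ^ (2 * r))

Profile : ℕ → ℕ → Set
Profile k m = (k ≡ 1 × m ≡ 1) ⊎ (k ≡ 6 × m ≡ 7) ⊎ (TwoPowPlus1 k × m ≡ k) ⊎ (FourPowMinus1 k × m ≡ k + 4) ⊎ m < k

IsF-TwoPowPlus1 : ∀ k → TwoPowPlus1 k → IsF k k
IsF-TwoPowPlus1 k (r , r≥2 , refl) = IsF-2^r+1 r r≥2

ones-FourPowMinus1 : ∀ h → FourPowMinus1 (ones (2 + 2 * h))
ones-FourPowMinus1 h = suc h , s≤s z≤n , trans (+-comm (ones (2 + 2 * h)) 1) (trans (suc-ones (2 + 2 * h)) (cong (2 ^_) (double-suc h)))
  where
  double-suc : ∀ h → 2 + 2 * h ≡ 2 * suc h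
  double-suc = solve-∀

IsF-FourPowMinus1 : ∀ k → FourPowMinus1 k → IsF k (k + 4)
IsF-FourPowMinus1 k (suc h , _ , k+1≡) = subst (λ x → IsF x (x + 4)) (sym k≡ones) (IsF-ones (2 * h) (parity-double h))
  where
  k≡ones : k ≡ ones (2 + 2 * h)
  k≡ones = suc-injective (trans (+-comm 1 k) (trans k+1≡ (trans (cong (2 ^_) (double-suc h)) (sym (suc-ones (2 + 2 * h))))))
    where
    double-suc : ∀ h → 2 * suc h ≡ 2 + 2 * h
    double-suc = solve-∀

profile-≤ : ∀ {k m} → Profile k m → m ≤ k + 4
profile-≤ (inj₁ (refl , refl)) = m≤m+n 1 4
profile-≤ (inj₂ (inj₁ (refl , refl))) = m≤m+n 7 3
profile-≤ {k} (inj₂ (inj₂ (inj₁ (_ , refl)))) = m≤m+n k 4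
profile-≤ (inj₂ (inj₂ (inj₂ (inj₁ (_ , refl))))) = ≤-refl
profile-≤ {k} (inj₂ (inj₂ (inj₂ (inj₂ m<k)))) = ≤-trans (<⇒≤ m<k) (m≤m+n k 4)

profile-double : ∀ q m → 1 ≤ q → IsF q m → Profile q m → Profile (2 * q) m
profile-double 1 m _ F _ rewrite IsF-unique 1 F IsF-1 = inj₂ (inj₂ (inj₂ (inj₂ (s≤s (s≤s z≤n)))))
profile-double 2 m _ F _ rewrite IsF-unique 2 F IsF-2 = inj₂ (inj₂ (inj₂ (inj₂ (s≤s (s≤s z≤n)))))
profile-double 3 m _ F _ rewrite IsF-unique 3 F IsF-3 = inj₂ (inj₁ (refl , refl))
profile-double 4 m _ F _ rewrite IsF-unique 4 F IsF-4 = inj₂ (inj₂ (inj₂ (inj₂ (s≤s (s≤s z≤n)))))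
profile-double (suc (suc (suc (suc (suc q))))) m _ _ prof = inj₂ (inj₂ (inj₂ (inj₂ (≤-<-trans (profile-≤ prof) (bound q)))))
  where
  bound : ∀ q → 5 + q + 4 < 2 * (5 + q)
  bound q = subst₂ _≤_ (lhs q) (rhs q) (m≤m+n (10 + q) q)
    where
    lhs : ∀ q → 10 + q ≡ suc (5 + q + 4)
    lhs = solve-∀
    rhs : ∀ q → 10 + q + q ≡ 2 * (5 + q)
    rhs = solve-∀

f-profile : ∀ k → 1 ≤ k → ∃[ m ] (IsF k m × Profile k m)
f-profile = binary-induction P (λ ()) double double+1
  where
  P : ℕ → Set
  P k = 1 ≤ k → ∃[ m ] (IsF k m × Profile k m)
  double : ∀ q → P q → P (2 * q)
  double zero _ ()
  double (suc q) ih _ with ih (s≤s z≤n)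
  ... | m , F , prof = m , Equivalence.from (IsF-double (suc q) m) F , profile-double (suc q) m (s≤s z≤n) F prof
  double+1 : ∀ q → P q → P (1 + 2 * q)
  double+1 q _ _ with odd-profile (leadingOnes (1 + 2 * q)) (parity-double+1 q)
  ... | inj₁ k≡1 = 1 , subst (λ k → IsF k 1) (sym k≡1) IsF-1 , inj₁ (k≡1 , refl)
  ... | inj₂ (inj₁ (h , k≡ones)) = 1 + 2 * q + 4 , subst (λ k → IsF k (k + 4)) (sym k≡ones) (IsF-ones (2 * h) (parity-double h)) ,
                                   inj₂ (inj₂ (inj₂ (inj₁ (subst FourPowMinus1 (sym k≡ones) (ones-FourPowMinus1 h) , refl))))
  ... | inj₂ (inj₂ (inj₁ 2^r+1)) = 1 + 2 * q , IsF-TwoPowPlus1 _ 2^r+1 , inj₂ (inj₂ (inj₁ (2^r+1 , refl)))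
  ... | inj₂ (inj₂ (inj₂ (n , n<k , odious))) with least-IsF (1 + 2 * q) n (odious⇒t≡1 ((1 + 2 * q) * n) odious)
  ...   | m , m≤n , F = m , F , inj₂ (inj₂ (inj₂ (inj₂ (≤-<-trans m≤n n<k))))

profile : ∀ {k m} → 1 ≤ k → IsF k m → Profile k m
profile {k} 1≤k F with f-profile k 1≤k
... | m′ , F′ , prof = subst (Profile k) (IsF-unique k F′ F) prof

profile-offset : ∀ {k j} → Profile k (k + j) →
                 (j ≡ 0 × (k ≡ 1 ⊎ TwoPowPlus1 k)) ⊎ (j ≡ 1 × k ≡ 6) ⊎ (j ≡ 4 × FourPowMinus1 k)
profile-offset {j = j} (inj₁ (refl , 1+j≡1)) = inj₁ (+-cancelˡ-≡ 1 j 0 1+j≡1 , inj₁ refl)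
profile-offset {j = j} (inj₂ (inj₁ (refl , 6+j≡7))) = inj₂ (inj₁ (+-cancelˡ-≡ 6 j 1 6+j≡7 , refl))
profile-offset {k} {j} (inj₂ (inj₂ (inj₁ (2^r+1 , k+j≡k)))) = inj₁ (+-cancelˡ-≡ k j 0 (trans k+j≡k (sym (+-identityʳ k))) , inj₂ 2^r+1)
profile-offset {k} {j} (inj₂ (inj₂ (inj₂ (inj₁ (4^r-1 , k+j≡k+4))))) = inj₂ (inj₂ (+-cancelˡ-≡ k j 4 k+j≡k+4 , 4^r-1))
profile-offset {k} {j} (inj₂ (inj₂ (inj₂ (inj₂ k+j<k)))) = ⊥-elim (m+n≮m k j k+j<k)

f≡k+4⇒4^r-1 : ∀ {k} → 1 ≤ k → IsF k (k + 4) → FourPowMinus1 k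
f≡k+4⇒4^r-1 1≤k F with profile-offset (profile 1≤k F)
... | inj₁ (() , _)
... | inj₂ (inj₁ (() , _))
... | inj₂ (inj₂ (_ , 4^r-1)) = 4^r-1

f≢k+3 : ∀ {k} → 1 ≤ k → ¬ IsF k (k + 3)
f≢k+3 1≤k F with profile-offset (profile 1≤k F)
... | inj₁ (() , _)
... | inj₂ (inj₁ (() , _))
... | inj₂ (inj₂ (() , _))

f≢k+2 : ∀ {k} → 1 ≤ k → ¬ IsF k (k + 2)
f≢k+2 1≤k F with profile-offset (profile 1≤k F)
... | inj₁ (() , _)
... | inj₂ (inj₁ (() , _))
... | inj₂ (inj₂ (() , _))

f≡k+1⇒k≡6 : ∀ {k} → 1 ≤ k → IsF k (k + 1) → k ≡ 6
f≡k+1⇒k≡6 1≤k F with profile-offset (profile 1≤k F)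
... | inj₁ (() , _)
... | inj₂ (inj₁ (_ , k≡6)) = k≡6
... | inj₂ (inj₂ (() , _))

f≡k⇒k≡1⊎2^r+1 : ∀ {k} → 1 ≤ k → IsF k k → k ≡ 1 ⊎ TwoPowPlus1 k
f≡k⇒k≡1⊎2^r+1 {k} 1≤k F with profile-offset (profile 1≤k (subst (IsF k) (sym (+-identityʳ k)) F))
... | inj₁ (_ , shape) = shape
... | inj₂ (inj₁ (() , _))
... | inj₂ (inj₂ (() , _))

theorem2 : (∀ k → k ≥ 1 → ∃[ m ] (IsF k m × m ≤ k + 4))
    × (∀ k → k ≥ 1 → (IsF k (k + 4) ⇔ (∃[ r ] (r ≥ 1 × k + 1 ≡ 2 ^ (2 * r)))))
    × (∀ k → k ≥ 1 → ¬ IsF k (k + 3) × ¬ IsF k (k + 2))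
    × (∀ k → k ≥ 1 → (IsF k (k + 1) ⇔ k ≡ 6))
    × (∀ k → k ≥ 1 → (IsF k k ⇔ (k ≡ 1 ⊎ ∃[ r ] (r ≥ 2 × k ≡ 2 ^ r + 1))))
theorem2 =
    (λ k 1≤k → let m , F , prof = f-profile k 1≤k in m , F , profile-≤ prof)
  , (λ k 1≤k → mk⇔ (f≡k+4⇒4^r-1 1≤k) (IsF-FourPowMinus1 k))
  , (λ k 1≤k → f≢k+3 1≤k , f≢k+2 1≤k)
  , (λ k 1≤k → mk⇔ (f≡k+1⇒k≡6 1≤k) λ { refl → IsF-6 })
  , (λ k 1≤k → mk⇔ (f≡k⇒k≡1⊎2^r+1 1≤k) λ { (inj₁ refl) → IsF-1 ; (inj₂ 2^r+1) → IsF-TwoPowPlus1 k 2^r+1 })
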